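{- For $n\ge 0$ and $k\ge 0$, the number $t_{n,k}$ of tilings of the honeycomb strip $H_n$ by monomers, slanted dimers and trimers using exactly $k$ trimers is $$t_{n,k}=\sum_{\substack{i_0,\dots,i_k\ge 0\\ i_0+\cdots+i_k=n-2k+1}}F_{i_0}F_{i_1}\cdots F_{i_k},$$ where $F_j$ are the Fibonacci numbers ($F_0=0$, $F_1=1$, $F_j=F_{j-1}+F_{j-2}$).
   Context: The honeycomb strip $H_n$ consists of $n$ regular hexagons numbered $1,\dots,n$ arranged in two rows (odd-numbered on the bottom, even-numbered on top), hexagon $i$ sharing an edge with hexagons $i\pm1$ and $i\pm2$. The allowed tiles are: monomers $\{i\}$, slanted dimers $\{i,i+1\}$, and trimers $\{i,i+1,i+2\}$ (horizontal dimers $\{i,i+2\}$ are not allowed); a tiling is a partition of the hexagons of $H_n$ into such tiles, and $H_0$ has one (empty) tiling. -}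

module Defs where

open import Data.Nat using (ℕ; zero; suc; _+_; _*_; _∸_; _≤_; _≤?_)
open import Data.List using (List; []; _∷_; map; concatMap; upTo)
open import Data.Nat.ListAction using (sum)
open import Data.Vec using (Vec; []; _∷_)
open import Relation.Nullary using (yes; no)

F : ℕ → ℕ
F zero = 0
F (suc zero) = 1
F (suc (suc j)) = F (suc j) + F j

-- All allowed tiles ({i}, {i,i+1}, {i,i+1,i+2}) are sets of consecutive
-- hexagons, so a tiling of H_n is determined by the tile containing
-- hexagon 1 together with a tiling of the remaining hexagons (a shifted
-- copy of a shorter strip).
data Tiling : ℕ → Set where
  empty   : Tiling zero
  monomer : ∀ {n} → Tiling n → Tiling (suc n)
  dimer   : ∀ {n} → Tiling n → Tiling (suc (suc n))
  trimer  : ∀ {n} → Tiling n → Tiling (suc (suc (suc n)))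

trimers : ∀ {n} → Tiling n → ℕ
trimers empty       = 0
trimers (monomer t) = trimers t
trimers (dimer t)   = trimers t
trimers (trimer t)  = suc (trimers t)

weakComps : (p m : ℕ) → List (Vec ℕ p)
weakComps zero zero    = [] ∷ []
weakComps zero (suc m) = []
weakComps (suc p) m    = concatMap (λ i → map (i ∷_) (weakComps p (m ∸ i))) (upTo (suc m))

prodF : ∀ {p} → Vec ℕ p → ℕ
prodF []       = 1
prodF (i ∷ is) = F i * prodF is

convF : (k m : ℕ) → ℕ
convF k m = sum (map prodF (weakComps (suc k) m))

-- Right-hand side of the theorem: the sum over i_0+⋯+i_k = n - 2k + 1;
-- when n - 2k + 1 < 0 the index set is empty and the sum is 0.
rhs : (n k : ℕ) → ℕ
rhs n k with (k + k) ≤? suc n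
... | yes _ = convF k (suc n ∸ (k + k))
... | no  _ = 0

-- A tiling of H_n is determined by its first tile and a tiling of the
-- remaining hexagons, so the number t(n,k) of tilings with k trimers obeys
-- t(n+1,k) = t(n,k) + t(n-1,k) + t(n-2,k-1).  Let C_p(m) be the sum of
-- F_{i_1}⋯F_{i_p} over i_1 + ⋯ + i_p = m.  Splitting off i_1 and using
-- F_{i+2} = F_{i+1} + F_i gives C_{p+1}(m+2) = C_{p+1}(m+1) + C_{p+1}(m) + C_p(m+1),
-- and C_{p+1}(0) = 0 because F_0 = 0.  Hence t(n,k) and C_{k+1}(n+1-2k)
-- satisfy the same recurrence with the same initial values.
module Submission where

open import Defs
open import Data.Nat using (ℕ; zero; suc; _+_; _*_; _∸_; _≤_; _≤?_; z≤n; s≤s)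
open import Data.Nat.Properties
  using (+-0-commutativeMonoid; +-identityʳ; +-comm; +-suc; *-zeroʳ; *-distribˡ-+; *-distribʳ-+;
         0∸n≡0; m≤n⇒m∸n≡0; m≤n⇒m≤o+n; <⇒≤; ≰⇒>)
open import Data.Nat.ListAction using (sum)
open import Data.Nat.ListAction.Properties using (sum-++)
open import Data.Fin using (Fin; zero; toℕ)
open import Data.Fin.Properties using (0↔⊥; +↔⊎)
open import Data.List using (List; []; _∷_; _++_; map; concatMap; applyUpTo; upTo)
open import Data.List.Properties using (map-++; map-cong)
open import Data.Vec using (Vec; _∷_)
open import Data.Product using (Σ; _,_)
open import Data.Sum using (_⊎_; inj₁; inj₂)
open import Data.Sum.Function.Propositional using (_⊎-↔_)
open import Data.Empty using (⊥)
open import Function.Bundles using (_↔_; mk↔ₛ′)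
open import Function.Properties.Inverse using (↔-refl; ↔-sym; ↔-trans)
open import Relation.Binary.PropositionalEquality
  using (_≡_; refl; sym; trans; cong; cong₂; subst; module ≡-Reasoning)
open import Relation.Nullary using (yes; no)
open import Algebra.Properties.CommutativeMonoid.Sum +-0-commutativeMonoid
  using (sum-syntax; ∑-distrib-+; sum-cong-≗)
  renaming (sum to ∑)

Tilings : ℕ → ℕ → Set
Tilings n k = Σ (Tiling n) (λ T → trimers T ≡ k)

AfterDimer : ℕ → ℕ → Set
AfterDimer zero    k = ⊥
AfterDimer (suc n) k = Tilings n k

AfterTrimer : ℕ → ℕ → Set
AfterTrimer n             zero    = ⊥
AfterTrimer (suc (suc n)) (suc k) = Tilings n k
AfterTrimer _             (suc k) = ⊥

firstTile-↔ : ∀ {n k} → Tilings (suc n) k ↔ ((Tilings n k ⊎ AfterDimer n k) ⊎ AfterTrimer n k)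
firstTile-↔ {n} {k} = mk↔ₛ′ split (join n k) (split∘join n k) join∘split
  where
  split : ∀ {n k} → Tilings (suc n) k → (Tilings n k ⊎ AfterDimer n k) ⊎ AfterTrimer n k
  split (monomer T , p)   = inj₁ (inj₁ (T , p))
  split (dimer T , p)     = inj₁ (inj₂ (T , p))
  split (trimer T , refl) = inj₂ (T , refl)

  join : ∀ n k → (Tilings n k ⊎ AfterDimer n k) ⊎ AfterTrimer n k → Tilings (suc n) k
  join n             k       (inj₁ (inj₁ (T , p))) = monomer T , p
  join (suc n)       k       (inj₁ (inj₂ (T , p))) = dimer T , p
  join (suc (suc n)) (suc k) (inj₂ (T , p))        = trimer T , cong suc p

  split∘join : ∀ n k x → split (join n k x) ≡ x
  split∘join n             k       (inj₁ (inj₁ _))   = refl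
  split∘join (suc n)       k       (inj₁ (inj₂ _))   = refl
  split∘join (suc (suc n)) (suc k) (inj₂ (T , refl)) = refl

  join∘split : ∀ {n k} x → join n k (split x) ≡ x
  join∘split (monomer T , p)   = refl
  join∘split (dimer T , p)     = refl
  join∘split (trimer T , refl) = refl

-- Splitting on k first makes #AfterTrimer n zero reduce to 0 for every n.
#Tilings     : ℕ → ℕ → ℕ
#AfterDimer  : ℕ → ℕ → ℕ
#AfterTrimer : ℕ → ℕ → ℕ
#Tilings zero    zero    = 1
#Tilings zero    (suc k) = 0
#Tilings (suc n) k       = #Tilings n k + #AfterDimer n k + #AfterTrimer n k
#AfterDimer zero    k = 0
#AfterDimer (suc n) k = #Tilings n k
#AfterTrimer n             zero    = 0
#AfterTrimer (suc (suc n)) (suc k) = #Tilings n k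
#AfterTrimer _             (suc k) = 0

Tilings↔Fin     : ∀ n k → Tilings n k ↔ Fin (#Tilings n k)
AfterDimer↔Fin  : ∀ n k → AfterDimer n k ↔ Fin (#AfterDimer n k)
AfterTrimer↔Fin : ∀ n k → AfterTrimer n k ↔ Fin (#AfterTrimer n k)
Tilings↔Fin zero zero =
  mk↔ₛ′ (λ _ → zero) (λ _ → empty , refl) (λ { zero → refl }) (λ { (empty , refl) → refl })
Tilings↔Fin zero (suc k) =
  mk↔ₛ′ (λ { (empty , ()) }) (λ ()) (λ ()) (λ { (empty , ()) })
Tilings↔Fin (suc n) k =
  ↔-trans firstTile-↔
    (↔-trans ((Tilings↔Fin n k ⊎-↔ AfterDimer↔Fin n k) ⊎-↔ AfterTrimer↔Fin n k)
      (↔-sym (↔-trans +↔⊎ (+↔⊎ ⊎-↔ ↔-refl))))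
AfterDimer↔Fin zero    k = ↔-sym 0↔⊥
AfterDimer↔Fin (suc n) k = Tilings↔Fin n k
AfterTrimer↔Fin n             zero    = ↔-sym 0↔⊥
AfterTrimer↔Fin zero          (suc k) = ↔-sym 0↔⊥
AfterTrimer↔Fin (suc zero)    (suc k) = ↔-sym 0↔⊥
AfterTrimer↔Fin (suc (suc n)) (suc k) = Tilings↔Fin n k

sum-map-concatMap : ∀ {A B : Set} (g : A → ℕ) (f : B → List A) (xs : List B) →
  sum (map g (concatMap f xs)) ≡ sum (map (λ x → sum (map g (f x))) xs)
sum-map-concatMap g f []       = refl
sum-map-concatMap g f (x ∷ xs) = begin
  sum (map g (f x ++ concatMap f xs))
    ≡⟨ cong sum (map-++ g (f x) (concatMap f xs)) ⟩
  sum (map g (f x) ++ map g (concatMap f xs))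
    ≡⟨ sum-++ (map g (f x)) (map g (concatMap f xs)) ⟩
  sum (map g (f x)) + sum (map g (concatMap f xs))
    ≡⟨ cong (sum (map g (f x)) +_) (sum-map-concatMap g f xs) ⟩
  sum (map g (f x)) + sum (map (λ x → sum (map g (f x))) xs) ∎
  where open ≡-Reasoning

sum-map-applyUpTo : ∀ (h f : ℕ → ℕ) n → sum (map h (applyUpTo f n)) ≡ ∑[ i < n ] (h (f (toℕ i)))
sum-map-applyUpTo h f zero    = refl
sum-map-applyUpTo h f (suc n) = cong (h (f 0) +_) (sum-map-applyUpTo h (λ i → f (suc i)) n)

sum-prodF-cons : ∀ {p} i (vs : List (Vec ℕ p)) →
  sum (map prodF (map (i ∷_) vs)) ≡ F i * sum (map prodF vs)
sum-prodF-cons i []       = sym (*-zeroʳ (F i))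
sum-prodF-cons i (v ∷ vs) =
  trans (cong (F i * prodF v +_) (sum-prodF-cons i vs)) (sym (*-distribˡ-+ (F i) (prodF v) _))

fibConv : ℕ → ℕ → ℕ
fibConv p m = sum (map prodF (weakComps p m))

fibConv-suc : ∀ p m → fibConv (suc p) m ≡ ∑[ i < suc m ] (F (toℕ i) * fibConv p (m ∸ toℕ i))
fibConv-suc p m = begin
  fibConv (suc p) m
    ≡⟨ sum-map-concatMap prodF (λ i → map (i ∷_) (weakComps p (m ∸ i))) (upTo (suc m)) ⟩
  sum (map (λ i → sum (map prodF (map (i ∷_) (weakComps p (m ∸ i))))) (upTo (suc m)))
    ≡⟨ cong sum (map-cong (λ i → sum-prodF-cons i (weakComps p (m ∸ i))) (upTo (suc m))) ⟩
  sum (map (λ i → F i * fibConv p (m ∸ i)) (upTo (suc m)))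
    ≡⟨ sum-map-applyUpTo (λ i → F i * fibConv p (m ∸ i)) (λ i → i) (suc m) ⟩
  ∑[ i < suc m ] (F (toℕ i) * fibConv p (m ∸ toℕ i)) ∎
  where open ≡-Reasoning

fibConv-zero : ∀ p → fibConv (suc p) 0 ≡ 0
fibConv-zero p = fibConv-suc p 0

fibConv-one : ∀ p → fibConv (suc p) 1 ≡ fibConv p 0
fibConv-one p = trans (fibConv-suc p 1) (trans (+-identityʳ _) (+-identityʳ _))

-- Peeling off the terms i = 0 (which vanishes as F 0 = 0) and i = 1 leaves
-- F (i + 2) = F (i + 1) + F i under the sum.
fibConv-recurrence : ∀ p j →
  fibConv (suc p) (suc (suc j)) ≡ fibConv (suc p) (suc j) + fibConv (suc p) j + fibConv p (suc j)
fibConv-recurrence p j = begin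
  fibConv (suc p) (suc (suc j))
    ≡⟨ fibConv-suc p (suc (suc j)) ⟩
  C (suc j) + 0 + ∑[ i < suc j ] ((F (suc (toℕ i)) + F (toℕ i)) * C (j ∸ toℕ i))
    ≡⟨ cong₂ _+_ (+-identityʳ (C (suc j)))
                 (sum-cong-≗ {suc j} (λ i → *-distribʳ-+ (C (j ∸ toℕ i)) (F (suc (toℕ i))) (F (toℕ i)))) ⟩
  C (suc j) + ∑[ i < suc j ] (G₁ i + G₀ i)
    ≡⟨ cong (C (suc j) +_) (∑-distrib-+ {suc j} G₁ G₀) ⟩
  C (suc j) + (∑[ i < suc j ] (G₁ i) + ∑[ i < suc j ] (G₀ i))
    ≡⟨ +-comm (C (suc j)) _ ⟩
  ∑[ i < suc j ] (G₁ i) + ∑[ i < suc j ] (G₀ i) + C (suc j)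
    ≡⟨ cong₂ (λ a b → a + b + C (suc j)) (sym (fibConv-suc p (suc j))) (sym (fibConv-suc p j)) ⟩
  fibConv (suc p) (suc j) + fibConv (suc p) j + C (suc j) ∎
  where
  open ≡-Reasoning
  C = fibConv p
  G₁ G₀ : Fin (suc j) → ℕ
  G₁ i = F (suc (toℕ i)) * C (j ∸ toℕ i)
  G₀ i = F (toℕ i) * C (j ∸ toℕ i)

fibConv-vanishes : ∀ p {m n} → m ≤ n → fibConv (suc p) (m ∸ n) ≡ 0
fibConv-vanishes p m≤n = trans (cong (fibConv (suc p)) (m≤n⇒m∸n≡0 m≤n)) (fibConv-zero p)

-- With at least two factors the recurrence survives truncated subtraction:
-- at arguments 1 and 0 both sides vanish.
fibConv-∸-recurrence : ∀ q m b →
  fibConv (suc (suc q)) (suc (suc m) ∸ b)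
    ≡ fibConv (suc (suc q)) (suc m ∸ b) + fibConv (suc (suc q)) (m ∸ b) + fibConv (suc q) (suc m ∸ b)
fibConv-∸-recurrence q m       zero    = fibConv-recurrence (suc q) m
fibConv-∸-recurrence q (suc m) (suc b) = fibConv-∸-recurrence q m b
fibConv-∸-recurrence q zero    (suc zero)
  rewrite fibConv-zero (suc q) = fibConv-one (suc q)
fibConv-∸-recurrence q zero    (suc (suc b))
  rewrite 0∸n≡0 b | fibConv-zero (suc q) | fibConv-zero q = refl

#Tilings≡fibConv     : ∀ n k → #Tilings n k ≡ fibConv (suc k) (suc n ∸ (k + k))
#AfterDimer≡fibConv  : ∀ n k → #AfterDimer n k ≡ fibConv (suc k) (n ∸ (k + k))
#AfterTrimer≡fibConv : ∀ n k → #AfterTrimer n (suc k) ≡ fibConv (suc k) (suc n ∸ (suc k + suc k))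
#Tilings≡fibConv zero    zero    = refl
#Tilings≡fibConv zero    (suc k) = sym (fibConv-vanishes (suc k) {1} {suc k + suc k} (s≤s z≤n))
#Tilings≡fibConv (suc n) zero    =
  trans (cong₂ (λ a b → a + b + 0) (#Tilings≡fibConv n 0) (#AfterDimer≡fibConv n 0))
        (sym (fibConv-recurrence 0 n))
#Tilings≡fibConv (suc n) (suc k) =
  trans (cong₂ _+_ (cong₂ _+_ (#Tilings≡fibConv n (suc k)) (#AfterDimer≡fibConv n (suc k)))
                   (#AfterTrimer≡fibConv n k))
        (sym (fibConv-∸-recurrence k n (suc k + suc k)))
#AfterDimer≡fibConv zero    k = sym (fibConv-vanishes k {0} {k + k} z≤n)
#AfterDimer≡fibConv (suc n) k = #Tilings≡fibConv n k
#AfterTrimer≡fibConv zero          k = sym (fibConv-vanishes k {1} {suc k + suc k} (s≤s z≤n))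
#AfterTrimer≡fibConv (suc zero)    k =
  sym (fibConv-vanishes k {2} {suc k + suc k} (s≤s (m≤n⇒m≤o+n k (s≤s z≤n))))
#AfterTrimer≡fibConv (suc (suc n)) k =
  trans (#Tilings≡fibConv n k) (cong (λ b → fibConv (suc k) (suc (suc n) ∸ b)) (sym (+-suc k k)))

fibConv≡rhs : ∀ n k → fibConv (suc k) (suc n ∸ (k + k)) ≡ rhs n k
fibConv≡rhs n k with k + k ≤? suc n
... | yes _       = refl
... | no 2k≰n+1 = fibConv-vanishes k (<⇒≤ (≰⇒> 2k≰n+1))

theorem9 : (n k : ℕ) → Σ (Tiling n) (λ T → trimers T ≡ k) ↔ Fin (rhs n k)
theorem9 n k =
  subst (λ m → Tilings n k ↔ Fin m) (trans (#Tilings≡fibConv n k) (fibConv≡rhs n k)) (Tilings↔Fin n k)
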